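{- Let $G=(V,E)$ be a finite simple graph that is $U$-threshold for some $U\subseteq V$, let $U^c=V\setminus U$, and let $\sim$ and $\trianglelefteq$ be as defined in the context. Then $\trianglelefteq$ is a total order on $V/\sim$; that is, the relation $\trianglelefteq$ on $V$ is transitive and total, $x\sim y$ implies $x\trianglelefteq y$, and $x\trianglelefteq y$ together with $y\trianglelefteq x$ implies $x\sim y$ (so $\trianglelefteq$ descends to a well-defined total order on the set of $\sim$-classes).
   Context: Graphs are finite, without loops or parallel edges. $N(v)$ denotes the neighbors of $v$; for $W\subseteq V$, $N_W(v)=N(v)\cap W$, $\deg_W(v)=|N_W(v)|$, and $G[W]$ is the induced subgraph. $G$ is $U$-threshold if for every nonempty $W\subseteq V$ the induced subgraph $G[W]$ contains a vertex $v$ with $N_W(v)=\emptyset$ or $N_W(v)=(W\setminus\{v\})\cap U$. Then $G[U]$ is threshold and has construction orders: orderings $u_1,\dots,u_k$ of $U$ in which each $u_i$ is adjacent either to none or to all of $u_1,\dots,u_{i-1}$. For $x,y\in U$ write $x\preceq y$ if either $\deg_U(x)=\deg_U(y)$, or $x$ precedes $y$ in every construction order of $G[U]$. Define $x\sim y$ on $V$ iff $\deg_U(x)=\deg_U(y)$, $\deg_{U^c}(x)=\deg_{U^c}(y)$, and either $x,y\in U$ or $x,y\in U^c$. Define $x\trianglelefteq y$ iff one of the following holds: (1) $x,y\in U$, $x\preceq y$, and $\deg_{U^c}(x)\ge\deg_{U^c}(y)$; (2) $x\in U$, $y\in U^c$, and $\{x,y\}\in E$; (3) $x\in U^c$, $y\in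 U$, and $\{x,y\}\notin E$; (4) $x,y\in U^c$ and $\deg_U(x)\le\deg_U(y)$. -}

module Defs where

open import Data.Nat using (ℕ; _≤_; _≥_)
open import Data.Fin using (Fin)
open import Data.Bool using (Bool; true; false; _∧_)
open import Data.List using (List; []; _∷_; _++_; length; filterᵇ; allFin)
open import Data.List.Relation.Unary.All using (All)
open import Data.List.Relation.Unary.Unique.Propositional using (Unique)
open import Data.List.Membership.Propositional using (_∈_)
open import Data.Product using (Σ; ∃; _×_; _,_)
open import Data.Sum using (_⊎_)
open import Relation.Binary.PropositionalEquality using (_≡_; _≢_)
open import Function.Bundles using (_⇔_)

record Graph (n : ℕ) : Set where
  field
    adj     : Fin n → Fin n → Bool
    sym     : ∀ x y → adj x y ≡ adj y x
    irrefl  : ∀ x → adj x x ≡ false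

VSet : ℕ → Set
VSet n = Fin n → Bool

module _ {n : ℕ} (G : Graph n) where
  open Graph G

  deg : VSet n → Fin n → ℕ
  deg W v = length (filterᵇ (λ w → W w ∧ adj v w) (allFin n))

  compl : VSet n → VSet n
  compl U x with U x
  ... | true  = false
  ... | false = true

  IsUThreshold : VSet n → Set
  IsUThreshold U =
    ∀ (W : VSet n) → (∃ λ w → W w ≡ true) →
    ∃ λ v → W v ≡ true ×
      ( (∀ w → W w ≡ true → adj v w ≡ false)
      ⊎ (∀ w → W w ≡ true → w ≢ v → (adj v w ≡ true ⇔ U w ≡ true)) )

  IsConstructionOrder : VSet n → List (Fin n) → Set
  IsConstructionOrder U l =
    Unique l ×
    (∀ x → (x ∈ l ⇔ U x ≡ true)) ×
    (∀ as b cs → l ≡ as ++ (b ∷ cs) →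
       All (λ a → adj b a ≡ false) as ⊎ All (λ a → adj b a ≡ true) as)

  Precedes : Fin n → Fin n → List (Fin n) → Set
  Precedes x y l = ∃ λ as → ∃ λ bs → ∃ λ cs → l ≡ as ++ (x ∷ bs ++ (y ∷ cs))

  Preceq : VSet n → Fin n → Fin n → Set
  Preceq U x y =
    deg U x ≡ deg U y
    ⊎ (∀ l → IsConstructionOrder U l → Precedes x y l)

  Sim : VSet n → Fin n → Fin n → Set
  Sim U x y =
    deg U x ≡ deg U y × deg (compl U) x ≡ deg (compl U) y ×
    ((U x ≡ true × U y ≡ true) ⊎ (U x ≡ false × U y ≡ false))

  Tle : VSet n → Fin n → Fin n → Set
  Tle U x y =
      (U x ≡ true × U y ≡ true × Preceq U x y × deg (compl U) x ≥ deg (compl U) y)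
    ⊎ (U x ≡ true × U y ≡ false × adj x y ≡ true)
    ⊎ (U x ≡ false × U y ≡ true × adj x y ≡ false)
    ⊎ (U x ≡ false × U y ≡ false × deg U x ≤ deg U y)

{-# OPTIONS --safe #-}
-- Call a vertex blocked in a vertex set W if it has a neighbour in W and is adjacent to a
-- non-U vertex of W or non-adjacent to another U-vertex of W; U-thresholdness says exactly that
-- no nonempty W consists of blocked vertices. Applied to sets of two and four vertices this shows
-- that U^c is independent and that two vertices on the same side of U never have private
-- neighbours of the same kind, so all the degree comparisons needed are comparisons of nested
-- neighbourhoods. Inside U, ⪯ is then described by degrees: if deg_U x ≠ deg_U y, then x ⪯ y
-- iff either x, y are adjacent and deg_U x < deg_U y, or they are not and deg_U y < deg_U x.
-- Such an x precedes y in every construction order, and a construction order exists, built from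
-- the back by repeatedly removing an isolated or U-dominating vertex.

module Submission where

open import Defs
open import Algebra.Properties.CommutativeSemigroup using (x∙yz≈y∙xz)
open import Data.Bool using (Bool; true; false; _∧_)
open import Data.Bool.Properties using (∧-zeroʳ)
open import Data.Fin using (Fin; zero; suc)
open import Data.Fin.Properties using (_≟_)
open import Data.List using (List; []; _∷_; _++_; length; filterᵇ; tabulate)
open import Data.List.Membership.Propositional using (_∈_)
open import Data.List.Membership.Propositional.Properties
  using (∈-++⁺ˡ; ∈-++⁺ʳ; ∈-++⁻; ∈-∃++)
open import Data.List.Properties using (++-conicalʳ; ++-assoc; ∷-injectiveˡ; ∷-injectiveʳ)
open import Data.List.Relation.Unary.All as All using (All; []; _∷_)
open import Data.List.Relation.Unary.AllPairs using ([]; _∷_)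
open import Data.List.Relation.Unary.Any using (here; there)
open import Data.List.Relation.Unary.Unique.Propositional using (Unique)
open import Data.List.Relation.Unary.Unique.Propositional.Properties using (++⁺)
open import Data.Nat using (ℕ; zero; suc; _+_; _≤_; _<_; z≤n; s≤s)
open import Data.Nat.Properties
  using ( ≤-refl; ≤-reflexive; ≤-trans; ≤-antisym; ≤-total; <⇒≤; <⇒≢; <⇒≱; <-asym; <-cmp
        ; n≤1+n; m≤n⇒m<n∨m≡n; suc-injective; +-mono-≤; +-mono-≤-<; +-commutativeSemigroup )
  renaming (_≟_ to _≟ℕ_)
open import Data.Product using (∃; _×_; _,_; proj₁; proj₂)
open import Data.Sum as Sum using (_⊎_; inj₁; inj₂)
open import Data.Vec.Functional using (updateAt)
open import Data.Vec.Functional.Properties using (updateAt-updates; updateAt-minimal)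
open import Function using (id; _∘_; _⇔_; mk⇔; Equivalence)
open import Relation.Binary using (tri<; tri≈; tri>)
open import Relation.Binary.PropositionalEquality
open import Relation.Nullary using (¬_; yes; no; does; contradiction)
open import Relation.Nullary.Decidable using (dec-true)

≡true⇔≡true⇒≡ : ∀ {a b} → (a ≡ true ⇔ b ≡ true) → a ≡ b
≡true⇔≡true⇒≡ {true}          a⇔b = sym (Equivalence.to a⇔b refl)
≡true⇔≡true⇒≡ {false} {true}  a⇔b = Equivalence.from a⇔b refl
≡true⇔≡true⇒≡ {false} {false} _   = refl

indicator : Bool → ℕ
indicator true  = 1
indicator false = 0

count : ∀ {m} → (Fin m → Bool) → ℕ
count {zero}  P = 0
count {suc m} P = indicator (P zero) + count (P ∘ suc)

remove : ∀ {m} → Fin m → (Fin m → Bool) → Fin m → Bool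
remove c P = updateAt P c (λ _ → false)

_⊆ᵇ_ : ∀ {m} → (Fin m → Bool) → (Fin m → Bool) → Set
P ⊆ᵇ Q = ∀ i → P i ≡ true → Q i ≡ true

count-mono : ∀ {m} {P Q : Fin m → Bool} → P ⊆ᵇ Q → count P ≤ count Q
count-mono {zero}  _   = z≤n
count-mono {suc m} {P} {Q} P⊆Q with P zero in p | Q zero in q
... | true  | true  = s≤s (count-mono (P⊆Q ∘ suc))
... | true  | false = contradiction (trans (sym (P⊆Q zero p)) q) λ ()
... | false | true  = ≤-trans (count-mono (P⊆Q ∘ suc)) (n≤1+n _)
... | false | false = count-mono (P⊆Q ∘ suc)

count-remove : ∀ {m} (c : Fin m) (P : Fin m → Bool) →
  count P ≡ indicator (P c) + count (remove c P)
count-remove zero    P = refl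
count-remove (suc c) P = begin
  indicator (P zero) + count (P ∘ suc)
    ≡⟨ cong (indicator (P zero) +_) (count-remove c (P ∘ suc)) ⟩
  indicator (P zero) + (indicator (P (suc c)) + count (remove c (P ∘ suc)))
    ≡⟨ x∙yz≈y∙xz +-commutativeSemigroup (indicator (P zero)) (indicator (P (suc c))) _ ⟩
  indicator (P (suc c)) + count (remove (suc c) P) ∎
  where open ≡-Reasoning

remove-other : ∀ {m} {c i : Fin m} (P : Fin m → Bool) → i ≢ c → remove c P i ≡ P i
remove-other {c = c} {i} P = updateAt-minimal i c P

remove-true⇔ : ∀ {m} (c : Fin m) (P : Fin m → Bool) i →
  remove c P i ≡ true ⇔ (i ≢ c × P i ≡ true)
remove-true⇔ c P i with i ≟ c
... | yes refl = mk⇔ (λ e → contradiction (trans (sym (updateAt-updates c P)) e) λ ())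
                     (λ (i≢c , _) → contradiction refl i≢c)
... | no i≢c   = mk⇔ (λ e → i≢c , trans (sym (remove-other P i≢c)) e)
                     (λ (_ , Pi) → trans (remove-other P i≢c) Pi)

remove-mono : ∀ {m} (c : Fin m) {P Q : Fin m → Bool} → P ⊆ᵇ Q → remove c P ⊆ᵇ remove c Q
remove-mono c {P} {Q} P⊆Q i e =
  let i≢c , Pi = Equivalence.to (remove-true⇔ c P i) e
  in Equivalence.from (remove-true⇔ c Q i) (i≢c , P⊆Q i Pi)

count-< : ∀ {m} {P Q : Fin m → Bool} (c : Fin m) → P c ≡ false → Q c ≡ true → P ⊆ᵇ Q →
  count P < count Q
count-< {P = P} {Q} c Pc Qc P⊆Q rewrite count-remove c P | count-remove c Q | Pc | Qc =
  s≤s (count-mono (remove-mono c P⊆Q))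

count-remove₂ : ∀ {m} {a b : Fin m} (P : Fin m → Bool) → a ≢ b → P a ≡ false →
  count P ≡ indicator (P b) + count (remove b (remove a P))
count-remove₂ {a = a} {b} P a≢b Pa = begin
  count P                                           ≡⟨ count-remove a P ⟩
  indicator (P a) + count (remove a P)
    ≡⟨ cong (λ x → indicator x + count (remove a P)) Pa ⟩
  count (remove a P)                                ≡⟨ count-remove b (remove a P) ⟩
  indicator (remove a P b) + count (remove b (remove a P))
    ≡⟨ cong (λ x → indicator x + count (remove b (remove a P))) (remove-other P (≢-sym a≢b)) ⟩
  indicator (P b) + count (remove b (remove a P))   ∎
  where open ≡-Reasoning

module _ {m} {a b : Fin m} {P Q : Fin m → Bool}
         (a≢b : a ≢ b) (Pa : P a ≡ false) (Qb : Q b ≡ false) (Pb≡Qa : P b ≡ Q a)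
         (P⊆Q : ∀ i → i ≢ a → i ≢ b → P i ≡ true → Q i ≡ true) where

  private
    removed⊆ : remove b (remove a P) ⊆ᵇ remove a (remove b Q)
    removed⊆ i e =
      let i≢b , e′ = Equivalence.to (remove-true⇔ b (remove a P) i) e
          i≢a , Pi = Equivalence.to (remove-true⇔ a P i) e′
      in Equivalence.from (remove-true⇔ a (remove b Q) i)
           (i≢a , Equivalence.from (remove-true⇔ b Q i) (i≢b , P⊆Q i i≢a i≢b Pi))

    exchanged : ∀ {R : ℕ → ℕ → Set} → R (indicator (P b) + count (remove b (remove a P)))
                                        (indicator (Q a) + count (remove a (remove b Q))) →
                R (count P) (count Q)
    exchanged {R} = subst₂ R (sym (count-remove₂ P a≢b Pa)) (sym (count-remove₂ Q (≢-sym a≢b) Qb))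

  count-exchange : count P ≤ count Q
  count-exchange =
    exchanged {_≤_} (+-mono-≤ (≤-reflexive (cong indicator Pb≡Qa)) (count-mono removed⊆))

  count-exchange-< : ∀ c → c ≢ a → c ≢ b → P c ≡ false → Q c ≡ true → count P < count Q
  count-exchange-< c c≢a c≢b Pc Qc =
    exchanged {_<_} (+-mono-≤-< (≤-reflexive (cong indicator Pb≡Qa)) (count-< c
      (trans (remove-other _ c≢b) (trans (remove-other P c≢a) Pc))
      (trans (remove-other _ c≢a) (trans (remove-other Q c≢b) Qc)) removed⊆))

count≡0⇔ : ∀ {m} {P : Fin m → Bool} → count P ≡ 0 ⇔ (∀ i → P i ≡ false)
count≡0⇔ {zero}      = mk⇔ (λ _ ()) (λ _ → refl)
count≡0⇔ {suc m} {P} with P zero in p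
... | true  = mk⇔ (λ ()) (λ h → contradiction (trans (sym p) (h zero)) λ ())
... | false = mk⇔ (λ e → λ { zero → p ; (suc i) → Equivalence.to count≡0⇔ e i })
                  (λ h → Equivalence.from count≡0⇔ (h ∘ suc))

count≡suc⇒∃ : ∀ {m k} (P : Fin m → Bool) → count P ≡ suc k → ∃ λ i → P i ≡ true
count≡suc⇒∃ {suc m} P e with P zero in p
... | true  = zero , p
... | false = let i , Pi = count≡suc⇒∃ (P ∘ suc) e in suc i , Pi

pattern first  = here refl
pattern second = there first
pattern third  = there second
pattern fourth = there third

split-unique : ∀ {A : Set} {v : A} xs ys xs′ ys′ → Unique (xs ++ v ∷ ys) →
  xs ++ v ∷ ys ≡ xs′ ++ v ∷ ys′ → xs ≡ xs′ × ys ≡ ys′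
split-unique []       ys []         ys′ _ e = refl , ∷-injectiveʳ e
split-unique {v = v} [] ys (a ∷ xs′) ys′ (v∉ys ∷ _) e =
  contradiction refl
    (All.lookup v∉ys (subst (v ∈_) (sym (∷-injectiveʳ e)) (∈-++⁺ʳ xs′ (here refl))))
split-unique (a ∷ xs) ys []         ys′ (a∉ ∷ _) e =
  contradiction (∷-injectiveˡ e) (All.lookup a∉ (∈-++⁺ʳ xs (here refl)))
split-unique (a ∷ xs) ys (a′ ∷ xs′) ys′ (_ ∷ u) e =
  let xs≡ , ys≡ = split-unique xs ys xs′ ys′ u (∷-injectiveʳ e)
  in cong₂ _∷_ (∷-injectiveˡ e) xs≡ , ys≡

snoc-split : ∀ {A : Set} (as : List A) b cs l v → as ++ b ∷ cs ≡ l ++ v ∷ [] →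
  (as ≡ l × b ≡ v) ⊎ ∃ λ cs′ → l ≡ as ++ b ∷ cs′
snoc-split []       b cs []       v e = inj₁ (refl , ∷-injectiveˡ e)
snoc-split []       b cs (a ∷ l)  v e = inj₂ (l , cong (_∷ l) (sym (∷-injectiveˡ e)))
snoc-split (a ∷ as) b cs []       v e with ++-conicalʳ as (b ∷ cs) (∷-injectiveʳ e)
... | ()
snoc-split (a ∷ as) b cs (a′ ∷ l) v e with snoc-split as b cs l v (∷-injectiveʳ e)
... | inj₁ (as≡l , b≡v) = inj₁ (cong₂ _∷_ (∷-injectiveˡ e) as≡l , b≡v)
... | inj₂ (cs′ , l≡)   = inj₂ (cs′ , cong₂ _∷_ (sym (∷-injectiveˡ e)) l≡)

module ConstructionOrders {n} (G : Graph n) where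
  open Graph G using (adj)

  precedes-trans : ∀ {x y z l} → Unique l → Precedes G x y l → Precedes G y z l → Precedes G x z l
  precedes-trans {x} {y} {z} u (as , bs , cs , refl) (as′ , bs′ , cs′ , e) =
    as , bs ++ y ∷ bs′ , cs′ , cong (λ t → as ++ x ∷ t) (begin
      bs ++ y ∷ cs                ≡⟨ cong (λ t → bs ++ y ∷ t) cs≡ ⟩
      bs ++ y ∷ bs′ ++ z ∷ cs′    ≡⟨ ++-assoc bs (y ∷ bs′) (z ∷ cs′) ⟨
      (bs ++ y ∷ bs′) ++ z ∷ cs′  ∎)
    where
    open ≡-Reasoning
    reassoc : as ++ x ∷ bs ++ y ∷ cs ≡ (as ++ x ∷ bs) ++ y ∷ cs
    reassoc = sym (++-assoc as (x ∷ bs) (y ∷ cs))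
    cs≡ : cs ≡ bs′ ++ z ∷ cs′
    cs≡ = proj₂ (split-unique (as ++ x ∷ bs) cs as′ (bs′ ++ z ∷ cs′)
                   (subst Unique reassoc u) (trans (sym reassoc) e))

  precedes-irrefl : ∀ {x l} → Unique l → ¬ Precedes G x x l
  precedes-irrefl u (as , bs , cs , refl) = go as u
    where
    go : ∀ {x bs cs} as → ¬ Unique (as ++ x ∷ bs ++ x ∷ cs)
    go {bs = bs} [] (x∉ ∷ _) = All.lookup x∉ (∈-++⁺ʳ bs (here refl)) refl
    go (_ ∷ as) (_ ∷ u) = go as u

  precedes-asym : ∀ {x y l} → Unique l → Precedes G x y l → ¬ Precedes G y x l
  precedes-asym u p q = precedes-irrefl u (precedes-trans u p q)

  precedes-total : ∀ {x y l} → x ∈ l → y ∈ l → x ≢ y → Precedes G x y l ⊎ Precedes G y x l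
  precedes-total {l = z ∷ l} (here refl) (here refl) x≢y = contradiction refl x≢y
  precedes-total {l = z ∷ l} (here refl) (there y∈l) _ =
    let bs , cs , e = ∈-∃++ y∈l in inj₁ ([] , bs , cs , cong (z ∷_) e)
  precedes-total {l = z ∷ l} (there x∈l) (here refl) _ =
    let bs , cs , e = ∈-∃++ x∈l in inj₂ ([] , bs , cs , cong (z ∷_) e)
  precedes-total {l = z ∷ l} (there x∈l) (there y∈l) x≢y with precedes-total x∈l y∈l x≢y
  ... | inj₁ (as , bs , cs , e) = inj₁ (z ∷ as , bs , cs , cong (z ∷_) e)
  ... | inj₂ (as , bs , cs , e) = inj₂ (z ∷ as , bs , cs , cong (z ∷_) e)

  precedes⇒∈-prefix : ∀ {x y l} → Precedes G x y l →
    ∃ λ p → ∃ λ s → l ≡ p ++ y ∷ s × x ∈ p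
  precedes⇒∈-prefix {x} {y} (as , bs , cs , refl) =
    as ++ x ∷ bs , cs , sym (++-assoc as (x ∷ bs) (y ∷ cs)) , ∈-++⁺ʳ as (here refl)

  adjacent-to-all-predecessors : ∀ {W l u v w} → IsConstructionOrder G W l →
    Precedes G u w l → Precedes G v w l → adj w u ≡ true → adj w v ≡ true
  adjacent-to-all-predecessors (uniq , _ , isolated-or-dominating) u<w v<w wu
    with precedes⇒∈-prefix u<w | precedes⇒∈-prefix v<w
  ... | p , s , refl , u∈p | p′ , s′ , e , v∈p′
    with refl , _ ← split-unique p s p′ s′ uniq e
    with isolated-or-dominating p _ s refl
  ... | inj₁ isolated  = contradiction (trans (sym wu) (All.lookup isolated u∈p)) λ ()
  ... | inj₂ dominating = All.lookup dominating v∈p′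

  snoc-isConstructionOrder : ∀ {W l v} → IsConstructionOrder G (remove v W) l → W v ≡ true →
    All (λ a → adj v a ≡ false) l ⊎ All (λ a → adj v a ≡ true) l →
    IsConstructionOrder G W (l ++ v ∷ [])
  snoc-isConstructionOrder {W} {l} {v} (uniq , mem , isolated-or-dominating) Wv last =
    ++⁺ uniq (All.[] ∷ []) v∉l , mem′ , isolated-or-dominating′
    where
    v∉l : ∀ {x} → ¬ (x ∈ l × x ∈ v ∷ [])
    v∉l (v∈l , first) =
      proj₁ (Equivalence.to (remove-true⇔ v W v) (Equivalence.to (mem v) v∈l)) refl
    mem′ : ∀ x → (x ∈ l ++ v ∷ [] ⇔ W x ≡ true)
    mem′ x = mk⇔ to from
      where
      to : x ∈ l ++ v ∷ [] → W x ≡ true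
      to x∈ with ∈-++⁻ l x∈
      ... | inj₁ x∈l = proj₂ (Equivalence.to (remove-true⇔ v W x) (Equivalence.to (mem x) x∈l))
      ... | inj₂ first = Wv
      from : W x ≡ true → x ∈ l ++ v ∷ []
      from Wx with x ≟ v
      ... | yes refl = ∈-++⁺ʳ l first
      ... | no x≢v   =
        ∈-++⁺ˡ (Equivalence.from (mem x) (Equivalence.from (remove-true⇔ v W x) (x≢v , Wx)))
    isolated-or-dominating′ : ∀ as b cs → l ++ v ∷ [] ≡ as ++ b ∷ cs →
      All (λ a → adj b a ≡ false) as ⊎ All (λ a → adj b a ≡ true) as
    isolated-or-dominating′ as b cs e with snoc-split as b cs l v (sym e)
    ... | inj₁ (refl , refl) = last
    ... | inj₂ (cs′ , e′)     = isolated-or-dominating as b cs′ e′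

length-filterᵇ-tabulate : ∀ {A : Set} {m} (p : A → Bool) (f : Fin m → A) →
  length (filterᵇ p (tabulate f)) ≡ count (p ∘ f)
length-filterᵇ-tabulate {m = zero}  p f = refl
length-filterᵇ-tabulate {m = suc m} p f with p (f zero)
... | true  = cong suc (length-filterᵇ-tabulate p (f ∘ suc))
... | false = length-filterᵇ-tabulate p (f ∘ suc)

module Degree {n} (G : Graph n) where
  open Graph G renaming (sym to adj-sym)

  neighbours : VSet n → Fin n → VSet n
  neighbours W v w = W w ∧ adj v w

  deg≡count : ∀ W v → deg G W v ≡ count (neighbours W v)
  deg≡count W v = length-filterᵇ-tabulate (neighbours W v) id

  neighbours-true⇔ : ∀ W {v w} → neighbours W v w ≡ true ⇔ (W w ≡ true × adj v w ≡ true)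
  neighbours-true⇔ W {v} {w} with W w
  ... | true  = mk⇔ (λ e → refl , e) proj₂
  ... | false = mk⇔ (λ ()) (λ ())

  neighbours-false : ∀ W {v w} → adj v w ≡ false → neighbours W v w ≡ false
  neighbours-false W {v} {w} e = trans (cong (W w ∧_) e) (∧-zeroʳ (W w))

  neighbours-mono : ∀ {W x y} → (∀ w → W w ≡ true → adj x w ≡ true → adj y w ≡ true) →
    neighbours W x ⊆ᵇ neighbours W y
  neighbours-mono {W} h w e = let Ww , xw = Equivalence.to (neighbours-true⇔ W) e
                              in Equivalence.from (neighbours-true⇔ W) (Ww , h w Ww xw)

  deg-mono : ∀ {W x y} → (∀ w → W w ≡ true → adj x w ≡ true → adj y w ≡ true) →
    deg G W x ≤ deg G W y
  deg-mono {W} {x} {y} h =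
    subst₂ _≤_ (sym (deg≡count W x)) (sym (deg≡count W y)) (count-mono (neighbours-mono h))

  deg-< : ∀ {W x y} → (∀ w → W w ≡ true → adj x w ≡ true → adj y w ≡ true) →
    ∀ c → W c ≡ true → adj x c ≡ false → adj y c ≡ true → deg G W x < deg G W y
  deg-< {W} {x} {y} h c Wc xc yc = subst₂ _<_ (sym (deg≡count W x)) (sym (deg≡count W y))
    (count-< c (neighbours-false W xc) (Equivalence.from (neighbours-true⇔ W) (Wc , yc))
               (neighbours-mono h))

  module _ {W : VSet n} {x y : Fin n} (x≢y : x ≢ y) (Wx≡Wy : W x ≡ W y)
           (h : ∀ w → W w ≡ true → w ≢ x → w ≢ y → adj x w ≡ true → adj y w ≡ true)
           where

    private
      exchanged : ∀ {R : ℕ → ℕ → Set} → R (count (neighbours W x)) (count (neighbours W y)) →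
                  R (deg G W x) (deg G W y)
      exchanged {R} = subst₂ R (sym (deg≡count W x)) (sym (deg≡count W y))

      swap : neighbours W x y ≡ neighbours W y x
      swap = cong₂ _∧_ (sym Wx≡Wy) (adj-sym x y)

      off-diagonal : ∀ w → w ≢ x → w ≢ y → neighbours W x w ≡ true → neighbours W y w ≡ true
      off-diagonal w w≢x w≢y e = let Ww , xw = Equivalence.to (neighbours-true⇔ W) e
                                 in Equivalence.from (neighbours-true⇔ W) (Ww , h w Ww w≢x w≢y xw)

    deg-exchange : deg G W x ≤ deg G W y
    deg-exchange = exchanged {_≤_} (count-exchange x≢y (neighbours-false W (irrefl x))
      (neighbours-false W (irrefl y)) swap off-diagonal)

    deg-exchange-< : ∀ c → c ≢ x → c ≢ y → W c ≡ true → adj x c ≡ false →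
      adj y c ≡ true → deg G W x < deg G W y
    deg-exchange-< c c≢x c≢y Wc xc yc = exchanged {_<_} (count-exchange-< x≢y
      (neighbours-false W (irrefl x)) (neighbours-false W (irrefl y)) swap off-diagonal
      c c≢x c≢y (neighbours-false W xc) (Equivalence.from (neighbours-true⇔ W) (Wc , yc)))

module Threshold {n} (G : Graph n) (U : VSet n) (threshold : IsUThreshold G U) where
  open Graph G renaming (sym to adj-sym)
  open Degree G
  open ConstructionOrders G
  open import Data.List.Membership.DecPropositional (_≟_ {n}) using (_∈?_)

  ∈?-true : ∀ {w ws} → w ∈ ws → does (w ∈? ws) ≡ true
  ∈?-true {w} {ws} = dec-true (w ∈? ws)

  ∈?-true⁻ : ∀ {w ws} → does (w ∈? ws) ≡ true → w ∈ ws
  ∈?-true⁻ {w} {ws} e with w ∈? ws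
  ... | yes w∈ = w∈

  adj-flip : ∀ {x y b} → adj x y ≡ b → adj y x ≡ b
  adj-flip {x} {y} = trans (adj-sym y x)

  adj⇒≢ : ∀ {v w} → adj v w ≡ true → w ≢ v
  adj⇒≢ {v} e refl = contradiction (trans (sym e) (irrefl v)) λ ()

  U-separates : ∀ {v w} → U v ≡ true → U w ≡ false → v ≢ w
  U-separates Uv Uw refl = contradiction (trans (sym Uv) Uw) λ ()

  Misfit : Fin n → Fin n → Set
  Misfit v w = w ≢ v × adj v w ≢ U w

  Blocked : List (Fin n) → Fin n → Set
  Blocked ws v = (∃ λ w → w ∈ ws × adj v w ≡ true) × (∃ λ w → w ∈ ws × Misfit v w)

  not-all-blocked : ∀ {v ws} → ¬ All (Blocked (v ∷ ws)) (v ∷ ws)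
  not-all-blocked {v} {ws} all-blocked
    with threshold (λ w → does (w ∈? (v ∷ ws))) (v , ∈?-true {v} {v ∷ ws} (here refl))
  ... | u , u∈ , isolated-or-dominating
    with All.lookup all-blocked (∈?-true⁻ u∈)
  ... | (w , w∈ , uw) , (m , m∈ , m≢u , um≢Um) with isolated-or-dominating
  ... | inj₁ isolated   = contradiction (trans (sym uw) (isolated w (∈?-true w∈))) λ ()
  ... | inj₂ dominating = um≢Um (≡true⇔≡true⇒≡ (dominating m (∈?-true m∈) m≢u))

  blocked-by-adj : ∀ {ws v w} → w ∈ ws → adj v w ≡ true → U w ≡ false → Blocked ws v
  blocked-by-adj w∈ vw Uw =
    (_ , w∈ , vw) , (_ , w∈ , adj⇒≢ vw , λ e → contradiction (trans (sym vw) (trans e Uw)) λ ())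

  blocked-by-pair : ∀ {ws v a b} → a ∈ ws → b ∈ ws → adj v a ≡ true → adj v b ≡ false →
    b ≢ v → U a ≡ U b → Blocked ws v
  blocked-by-pair {b = b} a∈ b∈ va vb b≢v Ua≡Ub with U b in Ub
  ... | false = blocked-by-adj a∈ va Ua≡Ub
  ... | true  =
    (_ , a∈ , va) , (_ , b∈ , b≢v , λ e → contradiction (trans (sym vb) (trans e Ub)) λ ())

  neighbourhoods-nested : ∀ {p q r s} → U p ≡ U q → U r ≡ U s → r ≢ p → s ≢ q →
    adj q r ≡ true → adj p r ≡ false → adj p s ≡ true → adj q s ≡ true
  neighbourhoods-nested {p} {q} {r} {s} Up≡Uq Ur≡Us r≢p s≢q qr pr ps with adj q s in qs
  ... | true  = refl
  ... | false = contradiction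
    ( blocked-by-pair fourth third ps pr r≢p (sym Ur≡Us)
    ∷ blocked-by-pair third fourth qr qs s≢q Ur≡Us
    ∷ blocked-by-pair second first (adj-flip qr) (adj-flip pr) (≢-sym r≢p) (sym Up≡Uq)
    ∷ blocked-by-pair first second (adj-flip ps) (adj-flip qs) (≢-sym s≢q) Up≡Uq
    ∷ []) not-all-blocked

  Uᶜ-independent : ∀ {x y} → U x ≡ false → U y ≡ false → adj x y ≡ false
  Uᶜ-independent {x} {y} Ux Uy with adj x y in xy
  ... | false = refl
  ... | true  = contradiction
    (blocked-by-adj second xy Uy ∷ blocked-by-adj first (adj-flip xy) Ux ∷ []) not-all-blocked

  dU dC : Fin n → ℕ
  dU = deg G U
  dC = deg G (compl G U)

  compl-true⇔ : ∀ {w} → compl G U w ≡ true ⇔ U w ≡ false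
  compl-true⇔ {w} with U w
  ... | true  = mk⇔ (λ ()) (λ ())
  ... | false = mk⇔ (λ _ → refl) (λ _ → refl)

  dC-Uᶜ≡0 : ∀ {x} → U x ≡ false → dC x ≡ 0
  dC-Uᶜ≡0 {x} Ux = trans (deg≡count (compl G U) x) (Equivalence.from count≡0⇔ no-neighbour)
    where
    no-neighbour : ∀ w → neighbours (compl G U) x w ≡ false
    no-neighbour w with compl G U w in Cw
    ... | false = refl
    ... | true  = Uᶜ-independent Ux (Equivalence.to compl-true⇔ Cw)

  Uᶜ-private-neighbour⇒dC-< : ∀ {p q r} → U p ≡ true → U q ≡ true → U r ≡ false →
    adj q r ≡ true → adj p r ≡ false → dC p < dC q
  Uᶜ-private-neighbour⇒dC-< {p} {q} {r} Up Uq Ur qr pr =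
    deg-< nested r (Equivalence.from compl-true⇔ Ur) pr qr
    where
    nested : ∀ s → compl G U s ≡ true → adj p s ≡ true → adj q s ≡ true
    nested s Cs = let Us = Equivalence.to compl-true⇔ Cs in
      neighbourhoods-nested (trans Up (sym Uq)) (trans Ur (sym Us))
        (≢-sym (U-separates Up Ur)) (≢-sym (U-separates Uq Us)) qr pr

  U-private-neighbour⇒dU-< : ∀ {p q r} → U p ≡ false → U q ≡ false → U r ≡ true →
    adj q r ≡ true → adj p r ≡ false → dU p < dU q
  U-private-neighbour⇒dU-< {p} {q} {r} Up Uq Ur qr pr = deg-< nested r Ur pr qr
    where
    nested : ∀ s → U s ≡ true → adj p s ≡ true → adj q s ≡ true
    nested s Us = neighbourhoods-nested (trans Up (sym Uq)) (trans Ur (sym Us))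
      (U-separates Ur Up) (U-separates Us Uq) qr pr

  _⊑_ : Fin n → Fin n → Set
  x ⊑ y = ∀ w → U w ≡ true → w ≢ x → w ≢ y → adj x w ≡ true → adj y w ≡ true

  ⊑⇒dU-≤ : ∀ {x y} → U x ≡ true → U y ≡ true → x ⊑ y → dU x ≤ dU y
  ⊑⇒dU-≤ {x} {y} Ux Uy x⊑y with x ≟ y
  ... | yes refl = ≤-refl
  ... | no x≢y   = deg-exchange x≢y (trans Ux (sym Uy)) x⊑y

  dU-≤⇒⊑ : ∀ {x y} → U x ≡ true → U y ≡ true → dU x ≤ dU y → x ⊑ y
  dU-≤⇒⊑ {x} {y} Ux Uy dx≤dy w Uw w≢x w≢y xw with adj y w in yw
  ... | true  = refl
  ... | false = contradiction dx≤dy (<⇒≱ (deg-exchange-< (≢-sym x≢y) (trans Uy (sym Ux)) y⊑x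
                  w w≢y w≢x Uw yw xw))
    where
    x≢y : x ≢ y
    x≢y refl = contradiction (trans (sym xw) yw) λ ()
    y⊑x : y ⊑ x
    y⊑x w′ Uw′ w′≢y w′≢x =
      neighbourhoods-nested (trans Uy (sym Ux)) (trans Uw (sym Uw′)) w≢y w′≢x xw yw

  same-dU⇒same-adj : ∀ {x y w} → U x ≡ true → U y ≡ true → dU x ≡ dU y →
    U w ≡ true → w ≢ x → w ≢ y → adj x w ≡ adj y w
  same-dU⇒same-adj {x} {y} {w} Ux Uy dx≡dy Uw w≢x w≢y with adj x w in xw | adj y w in yw
  ... | true  | true  = refl
  ... | false | false = refl
  ... | true  | false = trans (sym (dU-≤⇒⊑ Ux Uy (≤-reflexive dx≡dy) w Uw w≢x w≢y xw)) yw
  ... | false | true  = trans (sym xw) (dU-≤⇒⊑ Uy Ux (≤-reflexive (sym dx≡dy)) w Uw w≢y w≢x yw)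

  -- Adjacent vertices of different degrees appear in every construction order by increasing
  -- degree, non-adjacent ones by decreasing degree; x ≺ y says that x comes first.
  _≺_ _≼_ : Fin n → Fin n → Set
  x ≺ y = (adj x y ≡ true × dU x < dU y) ⊎ (adj x y ≡ false × dU y < dU x)
  x ≼ y = dU x ≡ dU y ⊎ x ≺ y

  ≺⇒dU-≢ : ∀ {x y} → x ≺ y → dU x ≢ dU y
  ≺⇒dU-≢ (inj₁ (_ , dx<dy)) = <⇒≢ dx<dy
  ≺⇒dU-≢ (inj₂ (_ , dy<dx)) = ≢-sym (<⇒≢ dy<dx)

  ≺⇒≢ : ∀ {x y} → x ≺ y → x ≢ y
  ≺⇒≢ x≺y refl = ≺⇒dU-≢ x≺y refl

  ≺⇒⋡ : ∀ {x y} → x ≺ y → ¬ y ≼ x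
  ≺⇒⋡ x≺y (inj₁ dy≡dx) = ≺⇒dU-≢ x≺y (sym dy≡dx)
  ≺⇒⋡ (inj₁ (_ , dx<dy))  (inj₂ (inj₁ (_ , dy<dx))) = <-asym dx<dy dy<dx
  ≺⇒⋡ (inj₁ (xy , _))     (inj₂ (inj₂ (yx , _)))    = contradiction (trans (sym xy) (adj-flip yx)) λ ()
  ≺⇒⋡ (inj₂ (xy , _))     (inj₂ (inj₁ (yx , _)))    = contradiction (trans (sym yx) (adj-flip xy)) λ ()
  ≺⇒⋡ (inj₂ (_ , dy<dx))  (inj₂ (inj₂ (_ , dx<dy))) = <-asym dx<dy dy<dx

  ≺-connex : ∀ x y → dU x ≢ dU y → x ≺ y ⊎ y ≺ x
  ≺-connex x y dx≢dy with adj x y in xy | <-cmp (dU x) (dU y)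
  ... | _     | tri≈ _ dx≡dy _ = contradiction dx≡dy dx≢dy
  ... | true  | tri< dx<dy _ _ = inj₁ (inj₁ (refl , dx<dy))
  ... | true  | tri> _ _ dy<dx = inj₂ (inj₁ (adj-flip xy , dy<dx))
  ... | false | tri< dx<dy _ _ = inj₂ (inj₂ (adj-flip xy , dx<dy))
  ... | false | tri> _ _ dy<dx = inj₁ (inj₂ (refl , dy<dx))

  ≺-respˡ-dU : ∀ {x y z} → U x ≡ true → U y ≡ true → U z ≡ true →
    dU x ≡ dU y → y ≺ z → x ≺ z
  ≺-respˡ-dU {x} {y} {z} Ux Uy Uz dx≡dy y≺z = transport y≺z
    where
    z≢x : z ≢ x
    z≢x refl = ≺⇒dU-≢ y≺z (sym dx≡dy)
    xz≡yz : adj x z ≡ adj y z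
    xz≡yz = same-dU⇒same-adj Ux Uy dx≡dy Uz z≢x (≢-sym (≺⇒≢ y≺z))
    transport : y ≺ z → x ≺ z
    transport (inj₁ (yz , dy<dz)) = inj₁ (trans xz≡yz yz , subst (_< dU z) (sym dx≡dy) dy<dz)
    transport (inj₂ (yz , dz<dy)) = inj₂ (trans xz≡yz yz , subst (dU z <_) (sym dx≡dy) dz<dy)

  ≺-respʳ-dU : ∀ {x y z} → U x ≡ true → U y ≡ true → U z ≡ true →
    x ≺ y → dU y ≡ dU z → x ≺ z
  ≺-respʳ-dU {x} {y} {z} Ux Uy Uz x≺y dy≡dz = transport x≺y
    where
    x≢z : x ≢ z
    x≢z refl = ≺⇒dU-≢ x≺y (sym dy≡dz)
    xz≡xy : adj x z ≡ adj x y
    xz≡xy = adj-flip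
      (trans (sym (same-dU⇒same-adj Uy Uz dy≡dz Ux (≺⇒≢ x≺y) x≢z)) (adj-sym y x))
    transport : x ≺ y → x ≺ z
    transport (inj₁ (xy , dx<dy)) = inj₁ (trans xz≡xy xy , subst (dU x <_) dy≡dz dx<dy)
    transport (inj₂ (xy , dy<dx)) = inj₂ (trans xz≡xy xy , subst (_< dU x) dy≡dz dy<dx)

  adjacent-Uᶜ-private-neighbour⇒⊑ : ∀ {a c u} → U a ≡ true → U c ≡ true →
    U u ≡ false → adj a u ≡ true → adj c u ≡ false → adj a c ≡ true → a ⊑ c
  adjacent-Uᶜ-private-neighbour⇒⊑ {a} {c} Ua Uc Uu au cu ac w Uw _ w≢c aw with adj c w in cw
  ... | true  = refl
  ... | false = contradiction
    ( blocked-by-adj second au Uu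
    ∷ blocked-by-pair first third (adj-flip au) (adj-flip cu) (U-separates Uc Uu) (trans Ua (sym Uc))
    ∷ blocked-by-pair first fourth (adj-flip ac) cw w≢c (trans Ua (sym Uw))
    ∷ blocked-by-pair first third (adj-flip aw) (adj-flip cw) (≢-sym w≢c) (trans Ua (sym Uc))
    ∷ []) not-all-blocked

  nonadjacent-Uᶜ-private-neighbour⇒⊒ : ∀ {a c u} → U a ≡ true → U c ≡ true →
    U u ≡ false → adj a u ≡ true → adj c u ≡ false → adj a c ≡ false → c ⊑ a
  nonadjacent-Uᶜ-private-neighbour⇒⊒ {a} {c} Ua Uc Uu au cu ac w Uw _ w≢a cw with adj a w in aw
  ... | true  = refl
  ... | false = contradiction
    ( blocked-by-adj second au Uu
    ∷ blocked-by-pair first third (adj-flip au) (adj-flip cu) (U-separates Uc Uu) (trans Ua (sym Uc))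
    ∷ blocked-by-pair fourth first cw (adj-flip ac) a≢c (trans Uw (sym Ua))
    ∷ blocked-by-pair third first (adj-flip cw) (adj-flip aw) (≢-sym w≢a) (trans Uc (sym Ua))
    ∷ []) not-all-blocked
    where
    a≢c : a ≢ c
    a≢c refl = contradiction (trans (sym au) cu) λ ()

  Uᶜ-private-neighbour⇒≼ : ∀ {a c u} → U a ≡ true → U c ≡ true → U u ≡ false →
    adj a u ≡ true → adj c u ≡ false → a ≼ c
  Uᶜ-private-neighbour⇒≼ {a} {c} Ua Uc Uu au cu with adj a c in ac
  ... | true
    with m≤n⇒m<n∨m≡n (⊑⇒dU-≤ Ua Uc (adjacent-Uᶜ-private-neighbour⇒⊑ Ua Uc Uu au cu ac))
  ...   | inj₁ da<dc = inj₂ (inj₁ (refl , da<dc))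
  ...   | inj₂ da≡dc = inj₁ da≡dc
  Uᶜ-private-neighbour⇒≼ {a} {c} Ua Uc Uu au cu | false
    with m≤n⇒m<n∨m≡n (⊑⇒dU-≤ Uc Ua (nonadjacent-Uᶜ-private-neighbour⇒⊒ Ua Uc Uu au cu ac))
  ...   | inj₁ dc<da = inj₂ (inj₂ (refl , dc<da))
  ...   | inj₂ dc≡da = inj₁ (sym dc≡da)

  ≺⇒dC-≥ : ∀ {x y} → U x ≡ true → U y ≡ true → x ≺ y → dC y ≤ dC x
  ≺⇒dC-≥ {x} {y} Ux Uy x≺y = deg-mono y⊆x
    where
    y⊆x : ∀ z → compl G U z ≡ true → adj y z ≡ true → adj x z ≡ true
    y⊆x z Cz yz with adj x z in xz
    ... | true  = refl
    ... | false = contradiction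
      (Uᶜ-private-neighbour⇒≼ Uy Ux (Equivalence.to compl-true⇔ Cz) yz xz) (≺⇒⋡ x≺y)

  precedes-total-in-U : ∀ {l x y} → IsConstructionOrder G U l → U x ≡ true → U y ≡ true →
    x ≢ y → Precedes G x y l ⊎ Precedes G y x l
  precedes-total-in-U {x = x} {y} (_ , mem , _) Ux Uy =
    precedes-total (Equivalence.from (mem x) Ux) (Equivalence.from (mem y) Uy)

  ≺⇒precedes : ∀ {x y l} → U x ≡ true → U y ≡ true → x ≺ y →
    IsConstructionOrder G U l → Precedes G x y l
  ≺⇒precedes {x} {y} Ux Uy x≺y co@(uniq , _) with precedes-total-in-U co Ux Uy (≺⇒≢ x≺y)
  ... | inj₁ x<y = x<y
  ... | inj₂ y<x with x≺y
  ... | inj₁ (xy , dx<dy) = contradiction (⊑⇒dU-≤ Uy Ux y⊑x) (<⇒≱ dx<dy)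
    where
    y⊑x : y ⊑ x
    y⊑x w Uw _ w≢x yw with precedes-total-in-U co Uw Ux w≢x
    ... | inj₁ w<x = adjacent-to-all-predecessors co y<x w<x xy
    ... | inj₂ x<w = adj-flip
      (adjacent-to-all-predecessors co (precedes-trans uniq y<x x<w) x<w (adj-flip yw))
  ... | inj₂ (xy , dy<dx) = contradiction (⊑⇒dU-≤ Ux Uy x⊑y) (<⇒≱ dy<dx)
    where
    x⊑y : x ⊑ y
    x⊑y w Uw w≢x _ xw with precedes-total-in-U co Uw Ux w≢x
    ... | inj₁ w<x = contradiction (trans (sym (adjacent-to-all-predecessors co w<x y<x xw)) xy) λ ()
    ... | inj₂ x<w = adj-flip
      (adjacent-to-all-predecessors co x<w (precedes-trans uniq y<x x<w) (adj-flip xw))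

  constructionOrder-exists : ∀ k W → count W ≡ k → (∀ w → W w ≡ true → U w ≡ true) →
    ∃ (IsConstructionOrder G W)
  constructionOrder-exists zero W |W|≡0 _ =
    [] , [] , (λ x → mk⇔ (λ ()) (λ Wx → contradiction (trans (sym Wx) (W-empty x)) λ ()))
       , λ { [] _ _ () ; (_ ∷ _) _ _ () }
    where
    W-empty : ∀ x → W x ≡ false
    W-empty = Equivalence.to count≡0⇔ |W|≡0
  constructionOrder-exists (suc k) W |W|≡1+k W⊆U
    with threshold W (count≡suc⇒∃ W |W|≡1+k)
  ... | v , Wv , isolated-or-dominating
    with constructionOrder-exists k (remove v W) |W-v|≡k
           (λ w e → W⊆U w (proj₂ (Equivalence.to (remove-true⇔ v W w) e)))
    where
    |W-v|≡k : count (remove v W) ≡ k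
    |W-v|≡k = suc-injective (trans (cong (λ b → indicator b + count (remove v W)) (sym Wv))
                                   (trans (sym (count-remove v W)) |W|≡1+k))
  ... | l , co@(_ , mem , _) =
    l ++ v ∷ [] , snoc-isConstructionOrder co Wv (last isolated-or-dominating)
    where
    in-W-v : ∀ {a} → a ∈ l → a ≢ v × W a ≡ true
    in-W-v {a} a∈l = Equivalence.to (remove-true⇔ v W a) (Equivalence.to (mem a) a∈l)
    last : (∀ w → W w ≡ true → adj v w ≡ false) ⊎
           (∀ w → W w ≡ true → w ≢ v → (adj v w ≡ true ⇔ U w ≡ true)) →
           All (λ a → adj v a ≡ false) l ⊎ All (λ a → adj v a ≡ true) l
    last (inj₁ isolated)   = inj₁ (All.tabulate λ a∈l → isolated _ (proj₂ (in-W-v a∈l)))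
    last (inj₂ dominating) = inj₂ (All.tabulate λ a∈l → let a≢v , Wa = in-W-v a∈l in
                                     Equivalence.from (dominating _ Wa a≢v) (W⊆U _ Wa))

  someConstructionOrder : ∃ (IsConstructionOrder G U)
  someConstructionOrder = constructionOrder-exists _ U refl (λ _ Uw → Uw)

  ≼-respˡ-dU : ∀ {x y z} → U x ≡ true → U y ≡ true → U z ≡ true →
    dU x ≡ dU y → y ≼ z → x ≼ z
  ≼-respˡ-dU _  _  _  dx≡dy (inj₁ dy≡dz) = inj₁ (trans dx≡dy dy≡dz)
  ≼-respˡ-dU Ux Uy Uz dx≡dy (inj₂ y≺z)   = inj₂ (≺-respˡ-dU Ux Uy Uz dx≡dy y≺z)

  ≼-respʳ-dU : ∀ {x y z} → U x ≡ true → U y ≡ true → U z ≡ true →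
    x ≼ y → dU y ≡ dU z → x ≼ z
  ≼-respʳ-dU _  _  _  (inj₁ dx≡dy) dy≡dz = inj₁ (trans dx≡dy dy≡dz)
  ≼-respʳ-dU Ux Uy Uz (inj₂ x≺y)   dy≡dz = inj₂ (≺-respʳ-dU Ux Uy Uz x≺y dy≡dz)

  Preceq⇒≼ : ∀ {x y} → U x ≡ true → U y ≡ true → Preceq G U x y → x ≼ y
  Preceq⇒≼ _ _ (inj₁ dx≡dy) = inj₁ dx≡dy
  Preceq⇒≼ {x} {y} Ux Uy (inj₂ x<y) with dU x ≟ℕ dU y
  ... | yes dx≡dy = inj₁ dx≡dy
  ... | no dx≢dy with ≺-connex x y dx≢dy | someConstructionOrder
  ... | inj₁ x≺y | _ = inj₂ x≺y
  ... | inj₂ y≺x | l , co =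
    contradiction (≺⇒precedes Uy Ux y≺x co) (precedes-asym (proj₁ co) (x<y l co))

  ≼⇒Preceq : ∀ {x y} → U x ≡ true → U y ≡ true → x ≼ y → Preceq G U x y
  ≼⇒Preceq _  _  (inj₁ dx≡dy) = inj₁ dx≡dy
  ≼⇒Preceq Ux Uy (inj₂ x≺y)   = inj₂ λ _ co → ≺⇒precedes Ux Uy x≺y co

  Preceq-trans : ∀ {x y z} → U x ≡ true → U y ≡ true → U z ≡ true →
    Preceq G U x y → Preceq G U y z → Preceq G U x z
  Preceq-trans Ux Uy Uz (inj₁ dx≡dy) y⪯z =
    ≼⇒Preceq Ux Uz (≼-respˡ-dU Ux Uy Uz dx≡dy (Preceq⇒≼ Uy Uz y⪯z))
  Preceq-trans Ux Uy Uz x⪯y (inj₁ dy≡dz) =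
    ≼⇒Preceq Ux Uz (≼-respʳ-dU Ux Uy Uz (Preceq⇒≼ Ux Uy x⪯y) dy≡dz)
  Preceq-trans _ _ _ (inj₂ x<y) (inj₂ y<z) =
    inj₂ λ l co → precedes-trans (proj₁ co) (x<y l co) (y<z l co)

  Preceq-antisym : ∀ {x y} → Preceq G U x y → Preceq G U y x → dU x ≡ dU y
  Preceq-antisym (inj₁ dx≡dy) _            = dx≡dy
  Preceq-antisym (inj₂ _)     (inj₁ dy≡dx) = sym dy≡dx
  Preceq-antisym (inj₂ x<y)   (inj₂ y<x) with someConstructionOrder
  ... | l , co = contradiction (y<x l co) (precedes-asym (proj₁ co) (x<y l co))

  ⊴ᵇ : Bool → Bool → Fin n → Fin n → Set
  ⊴ᵇ true  true  x y = Preceq G U x y × dC y ≤ dC x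
  ⊴ᵇ true  false x y = adj x y ≡ true
  ⊴ᵇ false true  x y = adj x y ≡ false
  ⊴ᵇ false false x y = dU x ≤ dU y

  Tle⇒⊴ᵇ : ∀ {x y} → Tle G U x y → ⊴ᵇ (U x) (U y) x y
  Tle⇒⊴ᵇ (inj₁ (Ux , Uy , x⪯y , dCy≤dCx))      rewrite Ux | Uy = x⪯y , dCy≤dCx
  Tle⇒⊴ᵇ (inj₂ (inj₁ (Ux , Uy , xy)))           rewrite Ux | Uy = xy
  Tle⇒⊴ᵇ (inj₂ (inj₂ (inj₁ (Ux , Uy , xy))))    rewrite Ux | Uy = xy
  Tle⇒⊴ᵇ (inj₂ (inj₂ (inj₂ (Ux , Uy , dx≤dy)))) rewrite Ux | Uy = dx≤dy

  ⊴ᵇ⇒Tle : ∀ {x y bx by} → U x ≡ bx → U y ≡ by → ⊴ᵇ bx by x y → Tle G U x y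
  ⊴ᵇ⇒Tle {bx = true}  {true}  Ux Uy x⊴y = inj₁ (Ux , Uy , x⊴y)
  ⊴ᵇ⇒Tle {bx = true}  {false} Ux Uy x⊴y = inj₂ (inj₁ (Ux , Uy , x⊴y))
  ⊴ᵇ⇒Tle {bx = false} {true}  Ux Uy x⊴y = inj₂ (inj₂ (inj₁ (Ux , Uy , x⊴y)))
  ⊴ᵇ⇒Tle {bx = false} {false} Ux Uy x⊴y = inj₂ (inj₂ (inj₂ (Ux , Uy , x⊴y)))

  ⊴ᵇ-trans : ∀ {x y z bx by bz} → U x ≡ bx → U y ≡ by → U z ≡ bz →
    ⊴ᵇ bx by x y → ⊴ᵇ by bz y z → ⊴ᵇ bx bz x z
  ⊴ᵇ-trans {bx = true} {true} {true} Ux Uy Uz (x⪯y , dCy≤dCx) (y⪯z , dCz≤dCy) =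
    Preceq-trans Ux Uy Uz x⪯y y⪯z , ≤-trans dCz≤dCy dCy≤dCx
  ⊴ᵇ-trans {x} {_} {z} {true} {true} {false} Ux Uy Uz (_ , dCy≤dCx) yz with adj x z in xz
  ... | true  = refl
  ... | false = contradiction dCy≤dCx (<⇒≱ (Uᶜ-private-neighbour⇒dC-< Ux Uy Uz yz xz))
  ⊴ᵇ-trans {bx = true} {false} {true} Ux Uy Uz xy yz =
    ≼⇒Preceq Ux Uz (Uᶜ-private-neighbour⇒≼ Ux Uz Uy xy (adj-flip yz)) ,
    <⇒≤ (Uᶜ-private-neighbour⇒dC-< Uz Ux Uy xy (adj-flip yz))
  ⊴ᵇ-trans {x} {_} {z} {true} {false} {false} Ux Uy Uz xy dy≤dz with adj x z in xz
  ... | true  = refl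
  ... | false = contradiction dy≤dz
                  (<⇒≱ (U-private-neighbour⇒dU-< Uz Uy Ux (adj-flip xy) (adj-flip xz)))
  ⊴ᵇ-trans {x} {_} {z} {false} {true} {true} Ux Uy Uz xy (_ , dCz≤dCy) with adj x z in xz
  ... | false = refl
  ... | true  = contradiction dCz≤dCy
                  (<⇒≱ (Uᶜ-private-neighbour⇒dC-< Uy Uz Ux (adj-flip xz) (adj-flip xy)))
  ⊴ᵇ-trans {bx = false} {true} {false} Ux Uy Uz xy yz =
    <⇒≤ (U-private-neighbour⇒dU-< Ux Uz Uy (adj-flip yz) xy)
  ⊴ᵇ-trans {x} {_} {z} {false} {false} {true} Ux Uy Uz dx≤dy yz with adj x z in xz
  ... | false = refl
  ... | true  = contradiction dx≤dy (<⇒≱ (U-private-neighbour⇒dU-< Uy Ux Uz xz yz))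
  ⊴ᵇ-trans {bx = false} {false} {false} _ _ _ dx≤dy dy≤dz = ≤-trans dx≤dy dy≤dz

  ⊴ᵇ-total : ∀ {bx by} x y → U x ≡ bx → U y ≡ by → ⊴ᵇ bx by x y ⊎ ⊴ᵇ by bx y x
  ⊴ᵇ-total {true} {true} x y Ux Uy with dU x ≟ℕ dU y
  ... | yes dx≡dy = Sum.map (inj₁ dx≡dy ,_) (inj₁ (sym dx≡dy) ,_) (≤-total (dC y) (dC x))
  ... | no dx≢dy  = Sum.map (λ x≺y → ≼⇒Preceq Ux Uy (inj₂ x≺y) , ≺⇒dC-≥ Ux Uy x≺y)
                            (λ y≺x → ≼⇒Preceq Uy Ux (inj₂ y≺x) , ≺⇒dC-≥ Uy Ux y≺x)
                            (≺-connex x y dx≢dy)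
  ⊴ᵇ-total {true} {false} x y _ _ with adj x y in xy
  ... | true  = inj₁ refl
  ... | false = inj₂ (adj-flip xy)
  ⊴ᵇ-total {false} {true} x y _ _ with adj x y in xy
  ... | false = inj₁ refl
  ... | true  = inj₂ (adj-flip xy)
  ⊴ᵇ-total {false} {false} x y _ _ = ≤-total (dU x) (dU y)

  ⊴ᵇ-antisym : ∀ {x y bx by} → U x ≡ bx → U y ≡ by →
    ⊴ᵇ bx by x y → ⊴ᵇ by bx y x → Sim G U x y
  ⊴ᵇ-antisym {bx = true}  {true}  Ux Uy (x⪯y , dCy≤dCx) (y⪯x , dCx≤dCy) =
    Preceq-antisym x⪯y y⪯x , ≤-antisym dCx≤dCy dCy≤dCx , inj₁ (Ux , Uy)
  ⊴ᵇ-antisym {bx = true}  {false} _ _ xy yx = contradiction (trans (sym xy) (adj-flip yx)) λ ()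
  ⊴ᵇ-antisym {bx = false} {true}  _ _ xy yx = contradiction (trans (sym (adj-flip yx)) xy) λ ()
  ⊴ᵇ-antisym {bx = false} {false} Ux Uy dx≤dy dy≤dx =
    ≤-antisym dx≤dy dy≤dx , trans (dC-Uᶜ≡0 Ux) (sym (dC-Uᶜ≡0 Uy)) , inj₂ (Ux , Uy)

  ⊴-trans : ∀ x y z → Tle G U x y → Tle G U y z → Tle G U x z
  ⊴-trans _ _ _ x⊴y y⊴z =
    ⊴ᵇ⇒Tle refl refl (⊴ᵇ-trans refl refl refl (Tle⇒⊴ᵇ x⊴y) (Tle⇒⊴ᵇ y⊴z))

  ⊴-total : ∀ x y → Tle G U x y ⊎ Tle G U y x
  ⊴-total x y = Sum.map (⊴ᵇ⇒Tle refl refl) (⊴ᵇ⇒Tle refl refl) (⊴ᵇ-total x y refl refl)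

  ∼⇒⊴ : ∀ x y → Sim G U x y → Tle G U x y
  ∼⇒⊴ _ _ (dx≡dy , dCx≡dCy , inj₁ (Ux , Uy)) =
    inj₁ (Ux , Uy , inj₁ dx≡dy , ≤-reflexive (sym dCx≡dCy))
  ∼⇒⊴ _ _ (dx≡dy , _ , inj₂ (Ux , Uy)) = inj₂ (inj₂ (inj₂ (Ux , Uy , ≤-reflexive dx≡dy)))

  ⊴-antisym : ∀ x y → Tle G U x y → Tle G U y x → Sim G U x y
  ⊴-antisym _ _ x⊴y y⊴x = ⊴ᵇ-antisym refl refl (Tle⇒⊴ᵇ x⊴y) (Tle⇒⊴ᵇ y⊴x)

proposition3p8 : ∀ {n : ℕ} (G : Graph n) (U : VSet n) → IsUThreshold G U →
    (∀ x y z → Tle G U x y → Tle G U y z → Tle G U x z) ×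
    (∀ x y → Tle G U x y ⊎ Tle G U y x) ×
    (∀ x y → Sim G U x y → Tle G U x y) ×
    (∀ x y → Tle G U x y → Tle G U y x → Sim G U x y)
proposition3p8 G U threshold = ⊴-trans , ⊴-total , ∼⇒⊴ , ⊴-antisym
  where open Threshold G U threshold
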